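{- Let $L\subseteq\{0,\dots,a-1\}$ with $|L|=r$. Then for every $n\ge1$, $$\sum_{\sigma\in C_a\wr S_n}q^{\overleftarrow{\min}_L(\sigma)}=(rq+a-r)(rq+2a-r)\cdots(rq+na-r).$$
   Context: Let $\alpha=e^{2\pi i/a}$. Elements of $C_a\wr S_n$ are colored permutations $\sigma=[\sigma(1),\dots,\sigma(n)]$ with $\sigma(j)=\alpha^{t_j}|\sigma(j)|$, $0\le t_j\le a-1$, where $|\sigma|=[|\sigma(1)|,\dots,|\sigma(n)|]\in S_n$ ($a^n n!$ elements). $\overleftarrow{\min}_L(\sigma)$ is the number of values $|\sigma(i)|$ which are right-to-left minima of $|\sigma|$ (i.e. $|\sigma(i)|<|\sigma(j)|$ for all $j>i$) and satisfy $t_i\in L$. -}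

module Defs where

open import Data.Nat using (ℕ; zero; suc; _∸_; _<ᵇ_) renaming (_*_ to _*ℕ_)
open import Data.Bool using (Bool; true; false; if_then_else_; _∧_; not)
open import Data.Fin using (Fin; toℕ; _≟_)
open import Data.Fin.Subset using (Subset)
open import Data.Vec using (Vec; []; _∷_; lookup)
open import Data.List using (List; []; _∷_; map; concatMap; filter; foldr)
open import Data.Product using (_×_; _,_)
open import Relation.Nullary.Decidable using (⌊_⌋)
open import Algebra.Bundles using (CommutativeSemiring)

allVecs : (k n : ℕ) → List (Vec (Fin k) n)
allVecs k zero = [] ∷ []
allVecs k (suc n) = concatMap (λ v → map (λ x → x ∷ v) (allFinL k)) (allVecs k n)
  where
  allFinL : (k : ℕ) → List (Fin k)
  allFinL zero = []
  allFinL (suc k) = Fin.zero ∷ map Fin.suc (allFinL k)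
    where import Data.Fin as Fin

notIn : ∀ {n m} → Fin n → Vec (Fin n) m → Bool
notIn x [] = true
notIn x (y ∷ v) = not ⌊ x ≟ y ⌋ ∧ notIn x v

distinct : ∀ {n m} → Vec (Fin n) m → Bool
distinct [] = true
distinct (x ∷ v) = notIn x v ∧ distinct v

-- S_n in one-line notation: injective words [σ(1),…,σ(n)] over Fin n
perms : (n : ℕ) → List (Vec (Fin n) n)
perms n = filter (λ v → Data.Bool._≟_ (distinct v) true) (allVecs n n)
  where import Data.Bool

-- C_a ≀ S_n : pairs (|σ|, colours t) with t_j ∈ {0,…,a-1}
coloredPerms : (a n : ℕ) → List (Vec (Fin n) n × Vec (Fin a) n)
coloredPerms a n = concatMap (λ p → map (λ t → p , t) (allVecs a n)) (perms n)

lessAll : ∀ {n m} → Fin n → Vec (Fin n) m → Bool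
lessAll x [] = true
lessAll x (y ∷ v) = (toℕ x <ᵇ toℕ y) ∧ lessAll x v

-- number of positions i with |σ(i)| a right-to-left minimum of |σ| and t_i ∈ L
rlminL : ∀ {a n m} → Subset a → Vec (Fin n) m → Vec (Fin a) m → ℕ
rlminL L [] [] = zero
rlminL L (p ∷ ps) (t ∷ ts) =
  (if lessAll p ps ∧ lookup L t then suc zero else zero) Data.Nat.+ rlminL L ps ts
  where import Data.Nat

module _ {c ℓ} (R : CommutativeSemiring c ℓ) where
  open CommutativeSemiring R

  fromℕ : ℕ → Carrier
  fromℕ zero = 0#
  fromℕ (suc n) = 1# + fromℕ n

  pow : Carrier → ℕ → Carrier
  pow x zero = 1#
  pow x (suc n) = x * pow x n

  rlminGF : (a n : ℕ) → Subset a → Carrier → Carrier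
  rlminGF a n L q = foldr (λ { (p , t) acc → pow q (rlminL L p t) + acc }) 0# (coloredPerms a n)

  rhsProd : (a r n : ℕ) → Carrier → Carrier
  rhsProd a r zero q = 1#
  rhsProd a r (suc n) q = rhsProd a r n q * (fromℕ r * q + fromℕ ((suc n *ℕ a) ∸ r))

module Submission where

-- Summing out the colours first, the sum over colourings of a fixed permutation factorises over
-- positions: a right-to-left minimum contributes r q + (a − r), any other position contributes a.
-- The resulting weighted sum over permutations is computed more generally for injective words of
-- length m over k letters, by locating the largest letter: it is a right-to-left minimum exactly
-- when it comes last, and it does not change the status of the other positions. Hence
--   S(k+1, m+1) = S(k, m+1) + S(k, m) · (r q + (a − r) + m a),
-- so S(k, m) = C(k, m) ∏_{i<m} (r q + (a − r) + i a), and the theorem is the case k = m = n.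

open import Defs
open import Data.Nat using (ℕ; _≥_)
open import Data.Fin.Subset using (Subset; ∣_∣)
open import Algebra.Bundles using (CommutativeSemiring)
open import Level using (Level)

open import Data.Bool using (Bool; true; false; if_then_else_; _∧_; not; T)
import Data.Bool
open import Data.Bool.Properties using (T-≡; T-∧)
open import Data.Nat using (zero; suc; _∸_; _≡ᵇ_; _<ᵇ_)
import Data.Nat as ℕ
import Data.Nat.Properties as ℕₚ
open import Data.Nat.Combinatorics using (_C_; nCn≡1; nCk+nC[k+1]≡[n+1]C[k+1])
open import Data.Fin as Fin using (Fin; zero; suc; toℕ; inject₁; _≟_)
import Data.Fin.Properties as Fin
open import Data.Fin.Subset.Properties using (∣p∣≤n)
open import Data.Vec using (Vec; []; _∷_; map; insertAt; lookup)
open import Data.List using (List; []; _∷_; _++_; concatMap; filter; foldr) renaming (map to mapList)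
open import Data.Product using (_,_; proj₁; proj₂)
open import Function using (_∘_; Injective; Equivalence)
open import Relation.Binary.PropositionalEquality as ≡ using (_≡_; _≢_)
import Relation.Binary.Reasoning.Setoid
open import Relation.Nullary using (yes; no)
open import Relation.Nullary.Decidable using (⌊_⌋; isYes≗does; dec-true; dec-false)

private
  variable
    k m n : ℕ

module Words where

  open ≡ using (refl; sym; trans; cong; cong₂)

  ⌊≟⌋-refl : (x : Fin n) → ⌊ x ≟ x ⌋ ≡ true
  ⌊≟⌋-refl x = trans (isYes≗does (x ≟ x)) (dec-true (x ≟ x) refl)

  ⌊≟⌋-≢ : {x y : Fin n} → x ≢ y → ⌊ x ≟ y ⌋ ≡ false
  ⌊≟⌋-≢ {x = x} {y} x≢y = trans (isYes≗does (x ≟ y)) (dec-false (x ≟ y) x≢y)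

  ⌊≟⌋-injective : (f : Fin n → Fin m) → Injective _≡_ _≡_ f →
                  ∀ x y → ⌊ f x ≟ f y ⌋ ≡ ⌊ x ≟ y ⌋
  ⌊≟⌋-injective f f-inj x y with x ≟ y
  ... | yes refl = ⌊≟⌋-refl (f x)
  ... | no x≢y   = ⌊≟⌋-≢ (x≢y ∘ f-inj)

  notIn-map : (f : Fin n → Fin m) → Injective _≡_ _≡_ f →
              (x : Fin n) (u : Vec (Fin n) k) → notIn (f x) (map f u) ≡ notIn x u
  notIn-map f f-inj x []      = refl
  notIn-map f f-inj x (y ∷ u) =
    cong₂ (λ b c → not b ∧ c) (⌊≟⌋-injective f f-inj x y) (notIn-map f f-inj x u)

  distinct-map : (f : Fin n → Fin m) → Injective _≡_ _≡_ f →
                 (u : Vec (Fin n) k) → distinct (map f u) ≡ distinct u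
  distinct-map f f-inj []      = refl
  distinct-map f f-inj (x ∷ u) = cong₂ _∧_ (notIn-map f f-inj x u) (distinct-map f f-inj u)

  lessAll-inject₁ : (x : Fin n) (u : Vec (Fin n) m) →
                    lessAll (inject₁ x) (map inject₁ u) ≡ lessAll x u
  lessAll-inject₁ x []      = refl
  lessAll-inject₁ x (y ∷ u) =
    cong₂ _∧_ (cong₂ _<ᵇ_ (Fin.toℕ-inject₁ x) (Fin.toℕ-inject₁ y)) (lessAll-inject₁ x u)

  occursOnce : Fin n → Vec (Fin n) m → Bool
  occursOnce y []      = false
  occursOnce y (x ∷ v) = if ⌊ y ≟ x ⌋ then notIn y v else occursOnce y v

  occursOnce-distinct : (y : Fin n) (v : Vec (Fin n) m) → T (distinct v) →
                        occursOnce y v ≡ not (notIn y v)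
  occursOnce-distinct y []      _    = refl
  occursOnce-distinct y (x ∷ v) dist with Equivalence.to T-∧ dist | y ≟ x
  ... | x∉v , _    | yes refl = Equivalence.to T-≡ x∉v
  ... | _   , dist′ | no _    = occursOnce-distinct y v dist′

  notIn-self∷ : (y : Fin n) (v : Vec (Fin n) m) → notIn y (y ∷ v) ≡ false
  notIn-self∷ y v = cong (λ b → not b ∧ notIn y v) (⌊≟⌋-refl y)

  notIn-≢∷ : {x y : Fin n} → y ≢ x → (v : Vec (Fin n) m) → notIn y (x ∷ v) ≡ notIn y v
  notIn-≢∷ {y = y} y≢x v = cong (λ b → not b ∧ notIn y v) (⌊≟⌋-≢ y≢x)

  occursOnce-self∷ : (y : Fin n) (v : Vec (Fin n) m) → occursOnce y (y ∷ v) ≡ notIn y v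
  occursOnce-self∷ y v = cong (λ b → if b then notIn y v else occursOnce y v) (⌊≟⌋-refl y)

  occursOnce-≢∷ : {x y : Fin n} → y ≢ x → (v : Vec (Fin n) m) → occursOnce y (x ∷ v) ≡ occursOnce y v
  occursOnce-≢∷ {y = y} y≢x v = cong (λ b → if b then notIn y v else occursOnce y v) (⌊≟⌋-≢ y≢x)

  insertTop : Vec (Fin k) m → Fin (suc m) → Vec (Fin (suc k)) (suc m)
  insertTop {k} u p = insertAt (map inject₁ u) p (Fin.fromℕ k)

  notIn-fromℕ-map-inject₁ : (u : Vec (Fin k) m) → notIn (Fin.fromℕ k) (map inject₁ u) ≡ true
  notIn-fromℕ-map-inject₁ []      = refl
  notIn-fromℕ-map-inject₁ (y ∷ u) =
    trans (notIn-≢∷ Fin.fromℕ≢inject₁ (map inject₁ u)) (notIn-fromℕ-map-inject₁ u)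

  notIn-insertTop : (x : Fin k) (u : Vec (Fin k) m) (p : Fin (suc m)) →
                    notIn (inject₁ x) (insertTop u p) ≡ notIn x u
  notIn-insertTop x u zero =
    trans (notIn-≢∷ (Fin.fromℕ≢inject₁ ∘ sym) (map inject₁ u))
          (notIn-map inject₁ Fin.inject₁-injective x u)
  notIn-insertTop x (y ∷ u) (suc p) =
    cong₂ (λ b c → not b ∧ c) (⌊≟⌋-injective inject₁ Fin.inject₁-injective x y)
          (notIn-insertTop x u p)

  distinct-insertTop : (u : Vec (Fin k) m) (p : Fin (suc m)) →
                       distinct (insertTop u p) ≡ distinct u
  distinct-insertTop u zero =
    cong₂ _∧_ (notIn-fromℕ-map-inject₁ u) (distinct-map inject₁ Fin.inject₁-injective u)
  distinct-insertTop (y ∷ u) (suc p) = cong₂ _∧_ (notIn-insertTop y u p) (distinct-insertTop u p)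

  inject₁<ᵇfromℕ : (x : Fin k) → (toℕ (inject₁ x) <ᵇ toℕ (Fin.fromℕ k)) ≡ true
  inject₁<ᵇfromℕ {k} x rewrite Fin.toℕ-inject₁ x | Fin.toℕ-fromℕ k =
    Equivalence.to T-≡ (ℕₚ.<⇒<ᵇ (Fin.toℕ<n x))

  lessAll-insertTop : (x : Fin k) (u : Vec (Fin k) m) (p : Fin (suc m)) →
                      lessAll (inject₁ x) (insertTop u p) ≡ lessAll x u
  lessAll-insertTop x u zero = cong₂ _∧_ (inject₁<ᵇfromℕ x) (lessAll-inject₁ x u)
  lessAll-insertTop x (y ∷ u) (suc p) =
    cong₂ _∧_ (cong₂ _<ᵇ_ (Fin.toℕ-inject₁ x) (Fin.toℕ-inject₁ y)) (lessAll-insertTop x u p)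

  fromℕ≮ᵇ : (y : Fin (suc k)) → (toℕ (Fin.fromℕ k) <ᵇ toℕ y) ≡ false
  fromℕ≮ᵇ {k} y rewrite Fin.toℕ-fromℕ k = dec-false (k ℕₚ.<? toℕ y) (ℕₚ.≤⇒≯ (Fin.toℕ≤pred[n] y))

  lessAll-fromℕ : (v : Vec (Fin (suc k)) m) → lessAll (Fin.fromℕ k) v ≡ (0 ≡ᵇ m)
  lessAll-fromℕ []      = refl
  lessAll-fromℕ {k} (y ∷ v) = cong (_∧ lessAll (Fin.fromℕ k) v) (fromℕ≮ᵇ y)

open Words

module Sums {c ℓ} (R : CommutativeSemiring c ℓ) where

  open CommutativeSemiring R hiding (zero)
  open import Algebra.Properties.Semiring.Sum semiring
    using (sum-syntax; sum-cong-≋; sum-cong-≗; sum-init-last; sum-replicate-zero;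
           ∑-distrib-+; ∑-comm; *-distribˡ-sum)
  open import Relation.Binary.Reasoning.Setoid setoid

  mask : Bool → Carrier → Carrier
  mask b x = if b then x else 0#

  mask-zero : ∀ b → mask b 0# ≈ 0#
  mask-zero true  = refl
  mask-zero false = refl

  mask-cong : ∀ b {x y} → x ≈ y → mask b x ≈ mask b y
  mask-cong true  x≈y = x≈y
  mask-cong false x≈y = refl

  mask-*ʳ : ∀ b x y → mask b x * y ≈ mask b (x * y)
  mask-*ʳ true  x y = refl
  mask-*ʳ false x y = zeroˡ y

  ∑-mask : ∀ b (f : Fin n → Carrier) → ∑[ i < n ] mask b (f i) ≈ mask b (∑[ i < n ] f i)
  ∑-mask     true  f = refl
  ∑-mask {n} false f = sum-replicate-zero n

  sumWords : (k m : ℕ) → (Vec (Fin k) m → Carrier) → Carrier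
  sumWords k zero    f = f []
  sumWords k (suc m) f = sumWords k m (λ v → ∑[ x < k ] f (x ∷ v))

  sumWords-cong : {f g : Vec (Fin k) m → Carrier} → (∀ v → f v ≈ g v) →
                  sumWords k m f ≈ sumWords k m g
  sumWords-cong {m = zero}  f≈g = f≈g []
  sumWords-cong {k} {suc m} f≈g = sumWords-cong {k} {m} (λ v → sum-cong-≋ (λ x → f≈g (x ∷ v)))

  sumWords-zero : ∀ k m → sumWords k m (λ _ → 0#) ≈ 0#
  sumWords-zero k zero    = refl
  sumWords-zero k (suc m) =
    trans (sumWords-cong {k} {m} (λ _ → sum-replicate-zero k)) (sumWords-zero k m)

  sumWords-distrib-+ : (f g : Vec (Fin k) m → Carrier) →
                       sumWords k m (λ v → f v + g v) ≈ sumWords k m f + sumWords k m g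
  sumWords-distrib-+ {m = zero}  f g = refl
  sumWords-distrib-+ {k} {suc m} f g =
    trans (sumWords-cong {k} {m} (λ v → ∑-distrib-+ (λ x → f (x ∷ v)) (λ x → g (x ∷ v))))
          (sumWords-distrib-+ {k} {m} _ _)

  *-distribˡ-sumWords : ∀ x (f : Vec (Fin k) m → Carrier) →
                        x * sumWords k m f ≈ sumWords k m (λ v → x * f v)
  *-distribˡ-sumWords {m = zero}  x f = refl
  *-distribˡ-sumWords {k} {suc m} x f =
    trans (*-distribˡ-sumWords {k} {m} x _)
          (sumWords-cong {k} {m} (λ v → *-distribˡ-sum x (λ y → f (y ∷ v))))

  *-distribʳ-sumWords : ∀ x (f : Vec (Fin k) m → Carrier) →
                        sumWords k m f * x ≈ sumWords k m (λ v → f v * x)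
  *-distribʳ-sumWords {k} {m} x f =
    trans (*-comm _ x)
          (trans (*-distribˡ-sumWords x f) (sumWords-cong {k} {m} (λ v → *-comm x (f v))))

  sumWords-∑-comm : (f : Fin n → Vec (Fin k) m → Carrier) →
                    sumWords k m (λ v → ∑[ i < n ] f i v) ≈ ∑[ i < n ] sumWords k m (f i)
  sumWords-∑-comm {m = zero}  f = refl
  sumWords-∑-comm {n} {k} {suc m} f =
    trans (sumWords-cong {k} {m} (λ v → ∑-comm (λ x i → f i (x ∷ v))))
          (sumWords-∑-comm {k = k} {m} (λ i v → ∑[ x < k ] f i (x ∷ v)))

  sumList : {A : Set} → List A → (A → Carrier) → Carrier
  sumList xs f = foldr (λ x acc → f x + acc) 0# xs

  sumList-cong : {A : Set} (xs : List A) {f g : A → Carrier} → (∀ x → f x ≈ g x) →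
                 sumList xs f ≈ sumList xs g
  sumList-cong []       f≈g = refl
  sumList-cong (x ∷ xs) f≈g = +-cong (f≈g x) (sumList-cong xs f≈g)

  sumList-++ : {A : Set} (xs ys : List A) (f : A → Carrier) →
               sumList (xs ++ ys) f ≈ sumList xs f + sumList ys f
  sumList-++ []       ys f = sym (+-identityˡ _)
  sumList-++ (x ∷ xs) ys f = trans (+-congˡ (sumList-++ xs ys f)) (sym (+-assoc _ _ _))

  sumList-map : {A B : Set} (g : A → B) (xs : List A) (f : B → Carrier) →
                sumList (mapList g xs) f ≡ sumList xs (f ∘ g)
  sumList-map g []       f = ≡.refl
  sumList-map g (x ∷ xs) f = ≡.cong (f (g x) +_) (sumList-map g xs f)

  sumList-concatMap : {A B : Set} (g : A → List B) (xs : List A) (f : B → Carrier) →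
                      sumList (concatMap g xs) f ≈ sumList xs (λ x → sumList (g x) f)
  sumList-concatMap g []       f = refl
  sumList-concatMap g (x ∷ xs) f =
    trans (sumList-++ (g x) (concatMap g xs) f) (+-congˡ (sumList-concatMap g xs f))

  sumList-filter : {A : Set} (h : A → Bool) (xs : List A) (f : A → Carrier) →
                   sumList (filter (λ x → h x Data.Bool.≟ true) xs) f ≈
                   sumList xs (λ x → mask (h x) (f x))
  sumList-filter h []       f = refl
  sumList-filter h (x ∷ xs) f with h x
  ... | true  = +-congˡ (sumList-filter h xs f)
  ... | false = trans (sumList-filter h xs f) (sym (+-identityˡ _))

  -- `allVecs` takes its letters from a list local to its `where` block; `letters` recovers it.
  letters : (k : ℕ) → List (Fin k)
  letters k = mapList Data.Vec.head (allVecs k 1)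

  private
    head-singletons : (l : List (Fin k)) →
                      mapList Data.Vec.head (concatMap (λ v → mapList (λ x → x ∷ v) l) ([] ∷ [])) ≡ l
    head-singletons []      = ≡.refl
    head-singletons (x ∷ l) = ≡.cong (x ∷_) (head-singletons l)

  allVecs-suc : ∀ k m →
                allVecs k (suc m) ≡ concatMap (λ v → mapList (λ x → x ∷ v) (letters k)) (allVecs k m)
  allVecs-suc k m =
    ≡.cong (λ l → concatMap (λ v → mapList (λ x → x ∷ v) l) (allVecs k m)) (≡.sym (head-singletons _))

  letters-suc : ∀ k → letters (suc k) ≡ zero ∷ mapList suc (letters k)
  letters-suc k =
    ≡.trans (head-singletons _) (≡.cong (λ l → zero ∷ mapList suc l) (≡.sym (head-singletons _)))

  sumList-letters : ∀ k (f : Fin k → Carrier) → sumList (letters k) f ≈ ∑[ x < k ] f x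
  sumList-letters zero    f = refl
  sumList-letters (suc k) f = begin
    sumList (letters (suc k)) f                  ≡⟨ ≡.cong (λ l → sumList l f) (letters-suc k) ⟩
    f zero + sumList (mapList suc (letters k)) f ≡⟨ ≡.cong (f zero +_) (sumList-map suc (letters k) f) ⟩
    f zero + sumList (letters k) (f ∘ suc)       ≈⟨ +-congˡ (sumList-letters k (f ∘ suc)) ⟩
    ∑[ x < suc k ] f x                           ∎

  sumList-allVecs : ∀ k m (f : Vec (Fin k) m → Carrier) → sumList (allVecs k m) f ≈ sumWords k m f
  sumList-allVecs k zero    f = +-identityʳ (f [])
  sumList-allVecs k (suc m) f = begin
    sumList (allVecs k (suc m)) f
      ≡⟨ ≡.cong (λ l → sumList l f) (allVecs-suc k m) ⟩
    sumList (concatMap (λ v → mapList (λ x → x ∷ v) (letters k)) (allVecs k m)) f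
      ≈⟨ sumList-concatMap _ (allVecs k m) f ⟩
    sumList (allVecs k m) (λ v → sumList (mapList (λ x → x ∷ v) (letters k)) f)
      ≈⟨ sumList-cong (allVecs k m) (λ v →
           trans (reflexive (sumList-map (λ x → x ∷ v) (letters k) f)) (sumList-letters k _)) ⟩
    sumList (allVecs k m) (λ v → ∑[ x < k ] f (x ∷ v))
      ≈⟨ sumList-allVecs k m _ ⟩
    sumWords k (suc m) f ∎

  sumList-coloredPerms : ∀ a n (f : Vec (Fin n) n → Vec (Fin a) n → Carrier) →
                         sumList (coloredPerms a n) (λ σ → f (proj₁ σ) (proj₂ σ)) ≈
                         sumList (perms n) (λ p → sumWords a n (f p))
  sumList-coloredPerms a n f =
    trans (sumList-concatMap _ (perms n) _)
          (sumList-cong (perms n) (λ p →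
            trans (reflexive (sumList-map (p ,_) (allVecs a n) _)) (sumList-allVecs a n (f p))))

  sumList-perms : ∀ n (f : Vec (Fin n) n → Carrier) →
                  sumList (perms n) f ≈ sumWords n n (λ v → mask (distinct v) (f v))
  sumList-perms n f = trans (sumList-filter distinct (allVecs n n) f) (sumList-allVecs n n _)

  ∑-fromℕ : (f : Fin (suc k) → Carrier) →
            ∑[ x < suc k ] f x ≈ f (Fin.fromℕ k) + ∑[ x < k ] f (inject₁ x)
  ∑-fromℕ f = trans (sum-init-last f) (+-comm _ _)

  sumWords-notIn-fromℕ : ∀ k m (g : Vec (Fin (suc k)) m → Carrier) →
                         sumWords (suc k) m (λ v → mask (notIn (Fin.fromℕ k) v) (g v)) ≈
                         sumWords k m (λ u → g (map inject₁ u))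
  sumWords-notIn-fromℕ k zero    g = refl
  sumWords-notIn-fromℕ k (suc m) g = begin
    sumWords (suc k) m (λ v → ∑[ x < suc k ] mask (notIn top (x ∷ v)) (g (x ∷ v)))
      ≈⟨ sumWords-cong {suc k} {m} split ⟩
    sumWords (suc k) m (λ v → mask (notIn top v) (∑[ x < k ] g (inject₁ x ∷ v)))
      ≈⟨ sumWords-notIn-fromℕ k m _ ⟩
    sumWords k (suc m) (λ u → g (map inject₁ u)) ∎
    where
    top = Fin.fromℕ k
    split : ∀ v → ∑[ x < suc k ] mask (notIn top (x ∷ v)) (g (x ∷ v)) ≈
                  mask (notIn top v) (∑[ x < k ] g (inject₁ x ∷ v))
    split v = begin
      ∑[ x < suc k ] mask (notIn top (x ∷ v)) (g (x ∷ v))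
        ≈⟨ ∑-fromℕ (λ x → mask (notIn top (x ∷ v)) (g (x ∷ v))) ⟩
      mask (notIn top (top ∷ v)) (g (top ∷ v)) +
      ∑[ x < k ] mask (notIn top (inject₁ x ∷ v)) (g (inject₁ x ∷ v))
        ≡⟨ ≡.cong₂ _+_ (≡.cong (λ b → mask b (g (top ∷ v))) (notIn-self∷ top v))
                       (sum-cong-≗ (λ x → ≡.cong (λ b → mask b (g (inject₁ x ∷ v)))
                                                  (notIn-≢∷ Fin.fromℕ≢inject₁ v))) ⟩
      0# + ∑[ x < k ] mask (notIn top v) (g (inject₁ x ∷ v))
        ≈⟨ +-identityˡ _ ⟩
      ∑[ x < k ] mask (notIn top v) (g (inject₁ x ∷ v))
        ≈⟨ ∑-mask (notIn top v) (λ x → g (inject₁ x ∷ v)) ⟩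
      mask (notIn top v) (∑[ x < k ] g (inject₁ x ∷ v)) ∎

  sumWords-occursOnce-fromℕ : ∀ k m (g : Vec (Fin (suc k)) (suc m) → Carrier) →
    sumWords (suc k) (suc m) (λ v → mask (occursOnce (Fin.fromℕ k) v) (g v)) ≈
    sumWords k m (λ u → ∑[ p < suc m ] g (insertTop u p))

  -- The words in which the single occurrence of the largest letter is not in front.
  sumWords-occursOnce-fromℕ-behind : ∀ k m (g : Vec (Fin (suc k)) (suc m) → Carrier) →
    sumWords (suc k) m (λ v → ∑[ x < k ] mask (occursOnce (Fin.fromℕ k) v) (g (inject₁ x ∷ v))) ≈
    sumWords k m (λ u → ∑[ p < m ] g (insertTop u (suc p)))

  sumWords-occursOnce-fromℕ k m g = begin
    sumWords (suc k) m (λ v → ∑[ x < suc k ] mask (occursOnce top (x ∷ v)) (g (x ∷ v)))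
      ≈⟨ sumWords-cong {suc k} {m} split ⟩
    sumWords (suc k) m (λ v → mask (notIn top v) (g (top ∷ v)) +
                              ∑[ x < k ] mask (occursOnce top v) (g (inject₁ x ∷ v)))
      ≈⟨ sumWords-distrib-+ {suc k} {m} _ _ ⟩
    sumWords (suc k) m (λ v → mask (notIn top v) (g (top ∷ v))) +
    sumWords (suc k) m (λ v → ∑[ x < k ] mask (occursOnce top v) (g (inject₁ x ∷ v)))
      ≈⟨ +-cong (sumWords-notIn-fromℕ k m (λ v → g (top ∷ v)))
                (sumWords-occursOnce-fromℕ-behind k m g) ⟩
    sumWords k m (λ u → g (insertTop u zero)) +
    sumWords k m (λ u → ∑[ p < m ] g (insertTop u (suc p)))
      ≈⟨ sumWords-distrib-+ {k} {m} _ _ ⟨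
    sumWords k m (λ u → ∑[ p < suc m ] g (insertTop u p)) ∎
    where
    top = Fin.fromℕ k
    split : ∀ v → ∑[ x < suc k ] mask (occursOnce top (x ∷ v)) (g (x ∷ v)) ≈
                  mask (notIn top v) (g (top ∷ v)) +
                  ∑[ x < k ] mask (occursOnce top v) (g (inject₁ x ∷ v))
    split v = trans (∑-fromℕ (λ x → mask (occursOnce top (x ∷ v)) (g (x ∷ v))))
      (reflexive (≡.cong₂ _+_ (≡.cong (λ b → mask b (g (top ∷ v))) (occursOnce-self∷ top v))
                              (sum-cong-≗ (λ x → ≡.cong (λ b → mask b (g (inject₁ x ∷ v)))
                                                         (occursOnce-≢∷ Fin.fromℕ≢inject₁ v)))))

  sumWords-occursOnce-fromℕ-behind k zero    g = sum-replicate-zero k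
  sumWords-occursOnce-fromℕ-behind k (suc m) g = begin
    sumWords (suc k) (suc m) (λ v → ∑[ x < k ] mask (occursOnce top v) (g (inject₁ x ∷ v)))
      ≈⟨ sumWords-∑-comm {k} {suc k} {suc m} (λ x v → mask (occursOnce top v) (g (inject₁ x ∷ v))) ⟩
    ∑[ x < k ] sumWords (suc k) (suc m) (λ v → mask (occursOnce top v) (g (inject₁ x ∷ v)))
      ≈⟨ sum-cong-≋ (λ x → sumWords-occursOnce-fromℕ k m (λ v → g (inject₁ x ∷ v))) ⟩
    ∑[ x < k ] sumWords k m (λ u → ∑[ p < suc m ] g (inject₁ x ∷ insertTop u p))
      ≈⟨ sumWords-∑-comm {k} {k} {m} (λ x u → ∑[ p < suc m ] g (inject₁ x ∷ insertTop u p)) ⟨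
    sumWords k (suc m) (λ u → ∑[ p < suc m ] g (insertTop u (suc p))) ∎
    where
    top = Fin.fromℕ k

  mask-distinct-split : (y : Fin n) (v : Vec (Fin n) m) (x : Carrier) →
                        mask (distinct v) x ≈
                        mask (notIn y v) (mask (distinct v) x) + mask (occursOnce y v) (mask (distinct v) x)
  mask-distinct-split y v x with distinct v in dist
  ... | false = sym (trans (+-cong (mask-zero (notIn y v)) (mask-zero (occursOnce y v))) (+-identityˡ 0#))
  ... | true rewrite occursOnce-distinct y v (Equivalence.from T-≡ dist) with notIn y v
  ...   | true  = sym (+-identityʳ x)
  ...   | false = sym (+-identityˡ x)


module RightToLeftMinima {c ℓ} (R : CommutativeSemiring c ℓ)
                         (w : Bool → CommutativeSemiring.Carrier R) where

  open CommutativeSemiring R hiding (zero)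
  open Sums R
  open import Algebra.Properties.Semiring.Sum semiring using (sum-syntax; sum-cong-≋; *-distribˡ-sum)
  open import Algebra.Properties.Semiring.Mult semiring using (_×_; ×-homo-+; ×-homo-1; ×-assoc-*)
  open import Algebra.Properties.CommutativeSemigroup +-commutativeSemigroup
    using () renaming (x∙yz≈y∙xz to x+yz≈y+xz)
  open import Relation.Binary.Reasoning.Setoid setoid

  weight : Vec (Fin k) m → Carrier
  weight []      = 1#
  weight (x ∷ v) = w (lessAll x v) * weight v

  weight-inject₁ : (u : Vec (Fin k) m) → weight (map inject₁ u) ≡ weight u
  weight-inject₁ []      = ≡.refl
  weight-inject₁ (x ∷ u) = ≡.cong₂ (λ b y → w b * y) (lessAll-inject₁ x u) (weight-inject₁ u)

  isLast : ∀ m → Fin (suc m) → Bool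
  isLast m p = toℕ p ≡ᵇ m

  weight-insertTop : (u : Vec (Fin k) m) (p : Fin (suc m)) →
                     weight (insertTop u p) ≈ weight u * w (isLast m p)
  weight-insertTop u zero =
    trans (*-cong (reflexive (≡.cong w (lessAll-fromℕ (map inject₁ u)))) (reflexive (weight-inject₁ u)))
          (*-comm _ _)
  weight-insertTop {m = suc m} (x ∷ u) (suc p) = begin
    w (lessAll (inject₁ x) (insertTop u p)) * weight (insertTop u p)
      ≈⟨ *-cong (reflexive (≡.cong w (lessAll-insertTop x u p))) (weight-insertTop u p) ⟩
    w (lessAll x u) * (weight u * w (isLast m p))
      ≈⟨ *-assoc _ _ _ ⟨
    weight (x ∷ u) * w (isLast (suc m) (suc p)) ∎

  risingFactor : ℕ → Carrier
  risingFactor m = w true + m × w false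

  risingProduct : ℕ → Carrier
  risingProduct zero    = 1#
  risingProduct (suc m) = risingProduct m * risingFactor m

  ∑-isLast : ∀ m → ∑[ p < suc m ] w (isLast m p) ≈ risingFactor m
  ∑-isLast zero    = refl
  ∑-isLast (suc m) = trans (+-congˡ (∑-isLast m)) (x+yz≈y+xz _ _ _)

  ∑-insertTop : (u : Vec (Fin k) m) →
                ∑[ p < suc m ] mask (distinct (insertTop u p)) (weight (insertTop u p)) ≈
                mask (distinct u) (weight u) * risingFactor m
  ∑-insertTop {m = m} u = begin
    ∑[ p < suc m ] mask (distinct (insertTop u p)) (weight (insertTop u p))
      ≈⟨ sum-cong-≋ (λ p → trans (reflexive (≡.cong (λ b → mask b (weight (insertTop u p)))
                                                    (distinct-insertTop u p)))
                                 (mask-cong (distinct u) (weight-insertTop u p))) ⟩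
    ∑[ p < suc m ] mask (distinct u) (weight u * w (isLast m p))
      ≈⟨ ∑-mask (distinct u) (λ p → weight u * w (isLast m p)) ⟩
    mask (distinct u) (∑[ p < suc m ] (weight u * w (isLast m p)))
      ≈⟨ mask-cong (distinct u) (*-distribˡ-sum (weight u) (λ p → w (isLast m p))) ⟨
    mask (distinct u) (weight u * ∑[ p < suc m ] w (isLast m p))
      ≈⟨ mask-cong (distinct u) (*-congˡ (∑-isLast m)) ⟩
    mask (distinct u) (weight u * risingFactor m)
      ≈⟨ mask-*ʳ (distinct u) (weight u) (risingFactor m) ⟨
    mask (distinct u) (weight u) * risingFactor m ∎

  injectiveSum : ℕ → ℕ → Carrier
  injectiveSum k m = sumWords k m (λ v → mask (distinct v) (weight v))

  injectiveSum-suc : ∀ k m → injectiveSum (suc k) (suc m) ≈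
                             injectiveSum k (suc m) + injectiveSum k m * risingFactor m
  injectiveSum-suc k m = begin
    sumWords (suc k) (suc m) f
      ≈⟨ sumWords-cong {suc k} {suc m} (λ v → mask-distinct-split top v (weight v)) ⟩
    sumWords (suc k) (suc m) (λ v → mask (notIn top v) (f v) + mask (occursOnce top v) (f v))
      ≈⟨ sumWords-distrib-+ {suc k} {suc m} (λ v → mask (notIn top v) (f v))
                                            (λ v → mask (occursOnce top v) (f v)) ⟩
    sumWords (suc k) (suc m) (λ v → mask (notIn top v) (f v)) +
    sumWords (suc k) (suc m) (λ v → mask (occursOnce top v) (f v))
      ≈⟨ +-cong (sumWords-notIn-fromℕ k (suc m) f) (sumWords-occursOnce-fromℕ k m f) ⟩
    sumWords k (suc m) (λ u → f (map inject₁ u)) +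
    sumWords k m (λ u → ∑[ p < suc m ] f (insertTop u p))
      ≈⟨ +-cong (sumWords-cong {k} {suc m} (λ u → reflexive (≡.cong₂ mask
                  (distinct-map inject₁ Fin.inject₁-injective u) (weight-inject₁ u))))
                (sumWords-cong {k} {m} ∑-insertTop) ⟩
    injectiveSum k (suc m) + sumWords k m (λ u → mask (distinct u) (weight u) * risingFactor m)
      ≈⟨ +-congˡ (*-distribʳ-sumWords {k} {m} (risingFactor m) (λ u → mask (distinct u) (weight u))) ⟨
    injectiveSum k (suc m) + injectiveSum k m * risingFactor m ∎
    where
    top = Fin.fromℕ k
    f : Vec (Fin (suc k)) (suc m) → Carrier
    f v = mask (distinct v) (weight v)

  injectiveSum≈C×risingProduct : ∀ k m → injectiveSum k m ≈ (k C m) × risingProduct m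
  injectiveSum≈C×risingProduct k       zero    = sym (+-identityʳ 1#)
  injectiveSum≈C×risingProduct zero    (suc m) = sumWords-zero 0 m
  injectiveSum≈C×risingProduct (suc k) (suc m) = begin
    injectiveSum (suc k) (suc m)
      ≈⟨ injectiveSum-suc k m ⟩
    injectiveSum k (suc m) + injectiveSum k m * risingFactor m
      ≈⟨ +-cong (injectiveSum≈C×risingProduct k (suc m))
                (*-congʳ (injectiveSum≈C×risingProduct k m)) ⟩
    (k C suc m) × risingProduct (suc m) + ((k C m) × risingProduct m) * risingFactor m
      ≈⟨ +-congˡ (×-assoc-* (k C m) _ _) ⟩
    (k C suc m) × risingProduct (suc m) + (k C m) × risingProduct (suc m)
      ≈⟨ +-comm _ _ ⟩
    (k C m) × risingProduct (suc m) + (k C suc m) × risingProduct (suc m)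
      ≈⟨ ×-homo-+ _ (k C m) (k C suc m) ⟨
    (k C m ℕ.+ k C suc m) × risingProduct (suc m)
      ≡⟨ ≡.cong (_× risingProduct (suc m)) (nCk+nC[k+1]≡[n+1]C[k+1] k m) ⟩
    (suc k C suc m) × risingProduct (suc m) ∎

  injectiveSum-diagonal : ∀ n → injectiveSum n n ≈ risingProduct n
  injectiveSum-diagonal n = begin
    injectiveSum n n          ≈⟨ injectiveSum≈C×risingProduct n n ⟩
    (n C n) × risingProduct n ≡⟨ ≡.cong (_× risingProduct n) (nCn≡1 n) ⟩
    1 × risingProduct n       ≈⟨ ×-homo-1 _ ⟩
    risingProduct n           ∎


module Colouring {c ℓ} (R : CommutativeSemiring c ℓ) (q : CommutativeSemiring.Carrier R) where

  open CommutativeSemiring R hiding (zero)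
  open Sums R
  open import Algebra.Properties.Semiring.Sum semiring
    using (sum-syntax; sum-cong-≋; sum-replicate; *-distribʳ-sum)
  open import Algebra.Properties.Semiring.Mult semiring using (_×_; ×-congʳ; ×-homo-+; ×-assocˡ)
  open import Algebra.Properties.Semiring.Exp semiring using (_^_; ^-homo-*)
  open import Algebra.Solver.Ring.NaturalCoefficients.Default R
  open import Relation.Binary.Reasoning.Setoid setoid

  pow≡^ : ∀ x n → pow R x n ≡ x ^ n
  pow≡^ x zero    = ≡.refl
  pow≡^ x (suc n) = ≡.cong (x *_) (pow≡^ x n)

  fromℕ≡×1# : ∀ n → fromℕ R n ≡ n × 1#
  fromℕ≡×1# zero    = ≡.refl
  fromℕ≡×1# (suc n) = ≡.cong (1# +_) (fromℕ≡×1# n)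

  pow-homo-* : ∀ x m n → pow R x (m ℕ.+ n) ≈ pow R x m * pow R x n
  pow-homo-* x m n = begin
    pow R x (m ℕ.+ n)     ≡⟨ pow≡^ x (m ℕ.+ n) ⟩
    x ^ (m ℕ.+ n)         ≈⟨ ^-homo-* x m n ⟩
    x ^ m * x ^ n         ≡⟨ ≡.cong₂ _*_ (pow≡^ x m) (pow≡^ x n) ⟨
    pow R x m * pow R x n ∎

  ∑-pow-lookup : ∀ {a} (L : Subset a) →
                 ∑[ i < a ] pow R q (if lookup L i then 1 else 0) ≈
                 fromℕ R ∣ L ∣ * q + fromℕ R (a ∸ ∣ L ∣)
  ∑-pow-lookup []          = solve 1 (λ q → con 0 := con 0 :* q :+ con 0) refl q
  ∑-pow-lookup {suc a} (true ∷ L)  = trans (+-congˡ (∑-pow-lookup L))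
    (solve 3 (λ q r s → q :* con 1 :+ (r :* q :+ s) := (con 1 :+ r) :* q :+ s)
             refl q (fromℕ R ∣ L ∣) (fromℕ R (a ∸ ∣ L ∣)))
  ∑-pow-lookup {suc a} (false ∷ L) = trans (+-congˡ (∑-pow-lookup L))
    (trans (solve 3 (λ q r s → con 1 :+ (r :* q :+ s) := r :* q :+ (con 1 :+ s))
                    refl q (fromℕ R ∣ L ∣) (fromℕ R (a ∸ ∣ L ∣)))
           (+-congˡ (reflexive (≡.cong (fromℕ R) (≡.sym (ℕₚ.+-∸-assoc 1 (∣p∣≤n L)))))))

  module _ {a} (L : Subset a) where

    colourWeight : Bool → Carrier
    colourWeight b = ∑[ i < a ] pow R q (if b ∧ lookup L i then 1 else 0)

    open RightToLeftMinima R colourWeight using (weight; risingFactor; risingProduct)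

    sumWords-rlminL : (p : Vec (Fin n) m) → sumWords a m (λ t → pow R q (rlminL L p t)) ≈ weight p
    sumWords-rlminL []      = refl
    sumWords-rlminL {m = suc m} (x ∷ p) = begin
      sumWords a m (λ t → ∑[ i < a ] pow R q (isMin i ℕ.+ rlminL L p t))
        ≈⟨ sumWords-cong {a} {m} (λ t → sum-cong-≋ (λ i → pow-homo-* q (isMin i) (rlminL L p t))) ⟩
      sumWords a m (λ t → ∑[ i < a ] (pow R q (isMin i) * pow R q (rlminL L p t)))
        ≈⟨ sumWords-cong {a} {m} (λ t →
             *-distribʳ-sum (pow R q (rlminL L p t)) (λ i → pow R q (isMin i))) ⟨
      sumWords a m (λ t → colourWeight (lessAll x p) * pow R q (rlminL L p t))
        ≈⟨ *-distribˡ-sumWords {a} {m} (colourWeight (lessAll x p)) (λ t → pow R q (rlminL L p t)) ⟨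
      colourWeight (lessAll x p) * sumWords a m (λ t → pow R q (rlminL L p t))
        ≈⟨ *-congˡ (sumWords-rlminL p) ⟩
      weight (x ∷ p) ∎
      where
      isMin : Fin a → ℕ
      isMin i = if lessAll x p ∧ lookup L i then 1 else 0

    risingFactor-colourWeight : ∀ m → risingFactor m ≈ fromℕ R ∣ L ∣ * q + fromℕ R (suc m ℕ.* a ∸ ∣ L ∣)
    risingFactor-colourWeight m = begin
      colourWeight true + m × colourWeight false
        ≈⟨ +-cong (∑-pow-lookup L) (×-congʳ m (sum-replicate a)) ⟩
      (fromℕ R r * q + fromℕ R (a ∸ r)) + m × (a × 1#)
        ≈⟨ +-assoc _ _ _ ⟩
      fromℕ R r * q + (fromℕ R (a ∸ r) + m × (a × 1#))
        ≈⟨ +-congˡ (+-cong (reflexive (fromℕ≡×1# (a ∸ r))) (×-assocˡ 1# m a)) ⟩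
      fromℕ R r * q + ((a ∸ r) × 1# + (m ℕ.* a) × 1#)
        ≈⟨ +-congˡ (×-homo-+ 1# (a ∸ r) (m ℕ.* a)) ⟨
      fromℕ R r * q + (a ∸ r ℕ.+ m ℕ.* a) × 1#
        ≡⟨ ≡.cong (λ s → fromℕ R r * q + s × 1#) (ℕₚ.+-∸-comm (m ℕ.* a) (∣p∣≤n L)) ⟨
      fromℕ R r * q + (suc m ℕ.* a ∸ r) × 1#
        ≡⟨ ≡.cong (fromℕ R r * q +_) (fromℕ≡×1# (suc m ℕ.* a ∸ r)) ⟨
      fromℕ R r * q + fromℕ R (suc m ℕ.* a ∸ r) ∎
      where r = ∣ L ∣

    risingProduct≈rhsProd : ∀ m → risingProduct m ≈ rhsProd R a ∣ L ∣ m q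
    risingProduct≈rhsProd zero    = refl
    risingProduct≈rhsProd (suc m) = *-cong (risingProduct≈rhsProd m) (risingFactor-colourWeight m)


proposition5p1 : ∀ {c ℓ : Level} (R : CommutativeSemiring c ℓ) (a : ℕ) (L : Subset a) (n : ℕ) →
    n ≥ 1 → (q : CommutativeSemiring.Carrier R) →
    CommutativeSemiring._≈_ R (rlminGF R a n L q) (rhsProd R a ∣ L ∣ n q)
proposition5p1 R a L n _ q = begin
  rlminGF R a n L q
    ≈⟨ sumList-coloredPerms a n (λ p t → pow R q (rlminL L p t)) ⟩
  sumList (perms n) (λ p → sumWords a n (λ t → pow R q (rlminL L p t)))
    ≈⟨ sumList-cong (perms n) (sumWords-rlminL L) ⟩
  sumList (perms n) weight
    ≈⟨ sumList-perms n weight ⟩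
  injectiveSum n n
    ≈⟨ injectiveSum-diagonal n ⟩
  risingProduct n
    ≈⟨ risingProduct≈rhsProd L n ⟩
  rhsProd R a ∣ L ∣ n q ∎
  where
  open CommutativeSemiring R using (setoid)
  open Relation.Binary.Reasoning.Setoid setoid
  open Sums R
  open Colouring R q
  open RightToLeftMinima R (colourWeight L)
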